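{- Let $k\ge 2$, let $G$ be a finite simple $k$-chromatic graph, and let $\{u,v\}$ be a pair of distinct vertices of $G$ which is an implicit-edge (respectively, an implicit-identity) of $G$. Let $0\le \ell\le k-2$ and let $S_1,\dots,S_\ell$ be vertex sets such that, with $G_0=G$ and $G_i=G_{i-1}-S_i$, each $S_i$ is a critical independent set of $G_{i-1}$ not containing $u$ nor $v$. Then in $H=G_\ell=G-(S_1\cup\dots\cup S_\ell)$ (which is $(k-\ell)$-chromatic), $\{u,v\}$ is an implicit-edge (respectively, an implicit-identity) of $H$.
   Context: All graphs are finite and simple. For a positive integer $k$, a $k$-coloring of a graph $G$ is a proper vertex coloring $c:V(G)\to\{1,\dots,k\}$; $\chi(G)$ is the chromatic number and $G$ is $k$-chromatic if $\chi(G)=k$. For distinct vertices $u,v$, $G-uv$ denotes $G$ with the edge $uv$ deleted if present (and $G$ otherwise). For a graph $F$ with $\chi(F)=m$ and distinct $u,v\in V(F)$: $\{u,v\}$ is an implicit-edge of $F$ if no $m$-coloring $c$ of $F-uv$ has $c(u)=c(v)$, and an implicit-identity of $F$ if no $m$-coloring $c$ of $F-uv$ has $c(u)\neq c(v)$. An independent set $S$ of an $m$-chromatic graph $F$ is critical if $\chi(F-S)=m-1$. -}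

module Defs where

open import Data.Nat using (ℕ; zero; suc; _<_; _∸_)
open import Data.Fin using (Fin; _≟_)
open import Data.Bool using (Bool; true; false; _∧_; _∨_; not)
open import Data.List using (List; []; _∷_)
open import Data.Product using (Σ; _×_)
open import Data.Unit using (⊤)
open import Relation.Nullary using (¬_)
open import Relation.Nullary.Decidable using (⌊_⌋)
open import Relation.Binary.PropositionalEquality using (_≡_; _≢_)

record SimpleGraph (n : ℕ) : Set where
  field
    adj    : Fin n → Fin n → Bool
    sym    : ∀ x y → adj x y ≡ adj y x
    irrefl : ∀ x → adj x x ≡ false
open SimpleGraph public

Subset : ℕ → Set
Subset n = Fin n → Bool

full : ∀ {n} → Subset n
full _ = true

_∖_ : ∀ {n} → Subset n → Subset n → Subset n
(P ∖ S) x = P x ∧ not (S x)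

delEdge : ∀ {n} → (Fin n → Fin n → Bool) → Fin n → Fin n → Fin n → Fin n → Bool
delEdge a u v x y =
  a x y ∧ not ((⌊ x ≟ u ⌋ ∧ ⌊ y ≟ v ⌋) ∨ (⌊ x ≟ v ⌋ ∧ ⌊ y ≟ u ⌋))

-- The graph F is represented by an adjacency function together with the set P
-- of its vertices: F is the subgraph induced on P.  A proper m-coloring of F:
Proper : ∀ {n m} → (Fin n → Fin n → Bool) → Subset n → (Fin n → Fin m) → Set
Proper a P c = ∀ x y → P x ≡ true → P y ≡ true → a x y ≡ true → c x ≢ c y

Colorable : ∀ {n} → (Fin n → Fin n → Bool) → Subset n → ℕ → Set
Colorable {n} a P m = Σ (Fin n → Fin m) (λ c → Proper a P c)

Chromatic : ∀ {n} → (Fin n → Fin n → Bool) → Subset n → ℕ → Set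
Chromatic a P m = Colorable a P m × (∀ j → j < m → ¬ Colorable a P j)

ImplicitEdge : ∀ {n} → SimpleGraph n → Subset n → Fin n → Fin n → Set
ImplicitEdge G P u v =
  ∀ m → Chromatic (adj G) P m →
  ∀ (c : Fin _ → Fin m) → Proper (delEdge (adj G) u v) P c → c u ≢ c v

ImplicitIdentity : ∀ {n} → SimpleGraph n → Subset n → Fin n → Fin n → Set
ImplicitIdentity G P u v =
  ∀ m → Chromatic (adj G) P m →
  ∀ (c : Fin _ → Fin m) → Proper (delEdge (adj G) u v) P c → c u ≡ c v

Independent : ∀ {n} → SimpleGraph n → Subset n → Subset n → Set
Independent G P S =
  (∀ x → S x ≡ true → P x ≡ true) ×
  (∀ x y → S x ≡ true → S y ≡ true → adj G x y ≡ false)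

CriticalIndependent : ∀ {n} → SimpleGraph n → Subset n → Subset n → Set
CriticalIndependent G P S =
  Independent G P S ×
  (∀ m → Chromatic (adj G) P m → Chromatic (adj G) (P ∖ S) (m ∸ 1))

removeAll : ∀ {n} → Subset n → List (Subset n) → Subset n
removeAll P []       = P
removeAll P (S ∷ Ss) = removeAll (P ∖ S) Ss

CriticalChain : ∀ {n} → SimpleGraph n → Subset n → Fin n → Fin n → List (Subset n) → Set
CriticalChain G P u v []       = ⊤
CriticalChain G P u v (S ∷ Ss) =
  CriticalIndependent G P S × S u ≡ false × S v ≡ false ×
  CriticalChain G (P ∖ S) u v Ss

module Submission where

-- Removing a critical independent set preserves implicit edges and identities.
--
-- Let F be m-chromatic and S a critical independent set of F avoiding u and v,
-- so that F - S is (m-1)-chromatic.  Any (m-1)-colouring c of (F - S) - uv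
-- extends to an m-colouring of F - uv by giving every vertex of S one fresh
-- colour: S is independent, and the fresh colour differs from all old ones.
-- The extension agrees with c (up to the embedding Fin (m-1) → Fin m) on u and
-- v, so a colouring of (F - S) - uv identifying (resp. separating) u and v
-- yields such a colouring of F - uv.  Hence an implicit edge (resp. identity)
-- of F stays one in F - S.

open import Defs hiding (sym)
open import Data.Nat using (ℕ; zero; suc; _≤_; _∸_)
open import Data.Nat.Properties using (<-cmp; ∸-+-assoc)
open import Data.Fin using (Fin; fromℕ; inject₁)
open import Data.Fin.Properties using (fromℕ≢inject₁; inject₁-injective)
open import Data.Bool using (Bool; true; false; if_then_else_)
open import Data.Bool.Properties using (∧-conicalˡ)
open import Data.List using (List; length; []; _∷_)
open import Data.Product using (_×_; _,_; proj₁; proj₂)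
open import Data.Empty using (⊥-elim)
open import Relation.Binary using (tri<; tri≈; tri>)
open import Relation.Binary.PropositionalEquality
  using (_≡_; _≢_; refl; sym; trans; cong; subst)

chromatic-unique : ∀ {n} {a : Fin n → Fin n → Bool} {P : Subset n} {m m′ : ℕ} →
  Chromatic a P m → Chromatic a P m′ → m ≡ m′
chromatic-unique {m = m} {m′} (col , min) (col′ , min′) with <-cmp m m′
... | tri< m<m′ _ _ = ⊥-elim (min′ m m<m′ col)
... | tri≈ _ m≡m′ _ = m≡m′
... | tri> _ _ m′<m = ⊥-elim (min m′ m′<m col′)

∈-∖ : ∀ {n} (P S : Subset n) {x : Fin n} →
  P x ≡ true → S x ≡ false → (P ∖ S) x ≡ true
∈-∖ P S Px Sx rewrite Px | Sx = refl

delEdge-⊆ : ∀ {n} (a : Fin n → Fin n → Bool) (u v x y : Fin n) →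
  delEdge a u v x y ≡ true → a x y ≡ true
delEdge-⊆ a u v x y = ∧-conicalˡ (a x y) _

independent-delEdge : ∀ {n} (G : SimpleGraph n) {P S : Subset n} (u v : Fin n) →
  Independent G P S →
  ∀ x y → S x ≡ true → S y ≡ true → delEdge (adj G) u v x y ≡ false
independent-delEdge G u v (_ , indep) x y Sx Sy with delEdge (adj G) u v x y in e
... | false = refl
... | true  with () ← trans (sym (delEdge-⊆ (adj G) u v x y e)) (indep x y Sx Sy)

extend : ∀ {n m} → Subset n → (Fin n → Fin m) → Fin n → Fin (suc m)
extend {m = m} S c x = if S x then fromℕ m else inject₁ (c x)

extend-outside : ∀ {n m} (S : Subset n) (c : Fin n → Fin m) {x : Fin n} →
  S x ≡ false → extend S c x ≡ inject₁ (c x)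
extend-outside S c Sx rewrite Sx = refl

extend-proper : ∀ {n m} (b : Fin n → Fin n → Bool) {P S : Subset n} {c : Fin n → Fin m} →
  (∀ x y → S x ≡ true → S y ≡ true → b x y ≡ false) →
  Proper b (P ∖ S) c → Proper b P (extend S c)
extend-proper b {P} {S} indep proper x y Px Py bxy same with S x in Sx | S y in Sy
... | true  | true  with () ← trans (sym bxy) (indep x y Sx Sy)
... | true  | false = fromℕ≢inject₁ same
... | false | true  = fromℕ≢inject₁ (sym same)
... | false | false = proper x y (∈-∖ P S Px Sx) (∈-∖ P S Py Sy) bxy (inject₁-injective same)

-- If χ(F - S) = χ(F) ∸ 1 and F - S has a vertex to colour, then χ(F) is
-- exactly χ(F - S) + 1 (the truncated subtraction did not hit zero).
pred-palette : ∀ {m m′ : ℕ} → Fin m′ → m′ ≡ m ∸ 1 → m ≡ suc m′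
pred-palette {zero}  () refl
pred-palette {suc m} _  refl = refl

module OneStep {n} (G : SimpleGraph n) {P S : Subset n} {u v : Fin n} {m : ℕ}
  (χP : Chromatic (adj G) P m) (critical : CriticalIndependent G P S)
  (u∉S : S u ≡ false) (v∉S : S v ≡ false) where

  private
    independent : Independent G P S
    independent = proj₁ critical

    χP∖S : Chromatic (adj G) (P ∖ S) (m ∸ 1)
    χP∖S = proj₂ critical m χP

  module Lift {m′ : ℕ} (χ′ : Chromatic (adj G) (P ∖ S) m′)
    (c : Fin n → Fin m′) (proper : Proper (delEdge (adj G) u v) (P ∖ S) c) where

    χP-suc : Chromatic (adj G) P (suc m′)
    χP-suc = subst (Chromatic (adj G) P)
      (pred-palette (c u) (chromatic-unique χ′ χP∖S)) χP

    lifted : Fin n → Fin (suc m′)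
    lifted = extend S c

    lifted-proper : Proper (delEdge (adj G) u v) P lifted
    lifted-proper = extend-proper (delEdge (adj G) u v)
      (independent-delEdge G u v independent) proper

    lifted-same⇔ : (c u ≡ c v → lifted u ≡ lifted v) × (lifted u ≡ lifted v → c u ≡ c v)
    lifted-same⇔ = to , from
      where
      open Relation.Binary.PropositionalEquality.≡-Reasoning
      to : c u ≡ c v → lifted u ≡ lifted v
      to cu≡cv = begin
        lifted u      ≡⟨ extend-outside S c u∉S ⟩
        inject₁ (c u) ≡⟨ cong inject₁ cu≡cv ⟩
        inject₁ (c v) ≡⟨ sym (extend-outside S c v∉S) ⟩
        lifted v      ∎
      from : lifted u ≡ lifted v → c u ≡ c v
      from lu≡lv = inject₁-injective (begin
        inject₁ (c u) ≡⟨ sym (extend-outside S c u∉S) ⟩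
        lifted u      ≡⟨ lu≡lv ⟩
        lifted v      ≡⟨ extend-outside S c v∉S ⟩
        inject₁ (c v) ∎)

  implicitEdge-step : ImplicitEdge G P u v → ImplicitEdge G (P ∖ S) u v
  implicitEdge-step edge m′ χ′ c proper cu≡cv =
    edge (suc m′) χP-suc lifted lifted-proper (proj₁ lifted-same⇔ cu≡cv)
    where open Lift χ′ c proper

  implicitIdentity-step : ImplicitIdentity G P u v → ImplicitIdentity G (P ∖ S) u v
  implicitIdentity-step identity m′ χ′ c proper =
    proj₂ lifted-same⇔ (identity (suc m′) χP-suc lifted lifted-proper)
    where open Lift χ′ c proper

chain-chromatic : ∀ {n} (G : SimpleGraph n) {P : Subset n} {u v : Fin n} {m : ℕ}
  (Ss : List (Subset n)) → Chromatic (adj G) P m → CriticalChain G P u v Ss →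
  Chromatic (adj G) (removeAll P Ss) (m ∸ length Ss)
chain-chromatic G []       χP _ = χP
chain-chromatic G {m = m} (S ∷ Ss) χP ((_ , critical) , _ , _ , chain) =
  subst (Chromatic (adj G) (removeAll _ Ss)) (∸-+-assoc m 1 (length Ss))
    (chain-chromatic G Ss (critical m χP) chain)

chain-transfer : ∀ {n} (G : SimpleGraph n) {u v : Fin n} (Q : Subset n → Set) →
  (∀ {P S m} → Chromatic (adj G) P m → CriticalIndependent G P S →
     S u ≡ false → S v ≡ false → Q P → Q (P ∖ S)) →
  ∀ {P m} (Ss : List (Subset n)) → Chromatic (adj G) P m →
  CriticalChain G P u v Ss → Q P → Q (removeAll P Ss)
chain-transfer G Q step []       _  _ q = q
chain-transfer G Q step {m = m} (S ∷ Ss) χP (critical , u∉S , v∉S , chain) q =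
  chain-transfer G Q step Ss (proj₂ critical m χP) chain
    (step χP critical u∉S v∉S q)

theorem3p10 : (k : ℕ) → 2 ≤ k → (n : ℕ) (G : SimpleGraph n) (u v : Fin n) → u ≢ v →
    Chromatic (adj G) full k →
    (Ss : List (Subset n)) → length Ss ≤ k ∸ 2 → CriticalChain G full u v Ss →
    Chromatic (adj G) (removeAll full Ss) (k ∸ length Ss) ×
    (ImplicitEdge G full u v → ImplicitEdge G (removeAll full Ss) u v) ×
    (ImplicitIdentity G full u v → ImplicitIdentity G (removeAll full Ss) u v)
theorem3p10 k _ n G u v _ χG Ss _ chain =
  chain-chromatic G Ss χG chain ,
  chain-transfer G (λ P → ImplicitEdge G P u v)
    (λ χP crit u∉S v∉S → OneStep.implicitEdge-step G χP crit u∉S v∉S) Ss χG chain ,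
  chain-transfer G (λ P → ImplicitIdentity G P u v)
    (λ χP crit u∉S v∉S → OneStep.implicitIdentity-step G χP crit u∉S v∉S) Ss χG chain
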